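{- Let $\mathcal{Q}$ be the commutative monoid with presentation \[\mathcal{Q}=\langle a,\,b,\,c,\,d_0,d_1,d_2,\ldots \mid a^2=1,\ bc=ab^3,\ c^2=b^4,\ b^{n+1}d_n=a^{n+1}b^{2n+5},\ cd_n=ab^2d_n\ (n\ge0),\ d_md_n=a^{m+1}b^{m+4}d_n\ (0\le m\le n)\rangle,\] and let \[\mathcal{P}=\{a\}\cup\{b^{2m}:m\ge1\}\cup\{b^md_n: m \text{ odd},\ n\text{ even},\ m<n\}\cup\{ab^md_n: m\text{ even},\ n\text{ odd},\ m<n\}\subseteq\mathcal{Q}.\] Then the bipartite monoid $(\mathcal{Q},\mathcal{P})$ is reduced: for any two distinct elements $x\neq y$ of $\mathcal{Q}$ there exists $z\in\mathcal{Q}$ such that exactly one of $xz$, $yz$ lies in $\mathcal{P}$.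
   Context: A bipartite monoid is a pair $(\mathcal{Q},\mathcal{P})$ where $\mathcal{Q}$ is a commutative monoid and $\mathcal{P}\subseteq\mathcal{Q}$. Elements $x,y\in\mathcal{Q}$ are distinguishable if there is $z\in\mathcal{Q}$ with exactly one of $xz,yz$ in $\mathcal{P}$; the bipartite monoid is reduced if every pair of distinct elements is distinguishable. -}

module Defs where

open import Data.Nat using (ℕ; zero; suc; _+_; _*_; _≤_; _<_)
open import Data.Nat.Divisibility using (_∣_)
open import Data.List using (List; []; _∷_; _++_; replicate)
open import Data.Product using (Σ; _×_; _,_)
open import Data.Sum using (_⊎_)
open import Relation.Nullary using (¬_)

data Gen : Set where
  a b c : Gen
  d : ℕ → Gen

Word : Set
Word = List Gen

_^_ : Gen → ℕ → Word
g ^ n = replicate n g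

data Rel : Word → Word → Set where
  comm  : (g h : Gen) → Rel (g ∷ h ∷ []) (h ∷ g ∷ [])
  r-a²  : Rel (a ^ 2) []
  r-bc  : Rel (b ∷ c ∷ []) (a ∷ b ^ 3)
  r-c²  : Rel (c ^ 2) (b ^ 4)
  r-bd  : (n : ℕ) → Rel (b ^ suc n ++ d n ∷ []) (a ^ suc n ++ b ^ (2 * n + 5))
  r-cd  : (n : ℕ) → Rel (c ∷ d n ∷ []) (a ∷ b ^ 2 ++ d n ∷ [])
  r-dd  : (m n : ℕ) → m ≤ n → Rel (d m ∷ d n ∷ []) (a ^ suc m ++ b ^ (m + 4) ++ d n ∷ [])

-- The monoid congruence generated by Rel: Q is Word modulo _≈_.
infix 4 _≈_
data _≈_ : Word → Word → Set where
  step   : ∀ p l r s → Rel l r → (p ++ l ++ s) ≈ (p ++ r ++ s)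
  ≈-refl : ∀ {x} → x ≈ x
  ≈-sym  : ∀ {x y} → x ≈ y → y ≈ x
  ≈-trans : ∀ {x y z} → x ≈ y → y ≈ z → x ≈ z

_·_ : Word → Word → Word
x · y = x ++ y

Even Odd : ℕ → Set
Even n = 2 ∣ n
Odd n = ¬ (2 ∣ n)

data PForm : Word → Set where
  pa  : PForm (a ∷ [])
  pb  : (m : ℕ) → 1 ≤ m → PForm (b ^ (2 * m))
  pbd : (m n : ℕ) → Odd m → Even n → m < n → PForm (b ^ m ++ d n ∷ [])
  pabd : (m n : ℕ) → Even m → Odd n → m < n → PForm (a ∷ b ^ m ++ d n ∷ [])

InP : Word → Set
InP x = Σ Word (λ w → PForm w × x ≈ w)

Distinguishable : Word → Word → Set
Distinguishable x y =
  Σ Word (λ z → (InP (x · z) × ¬ InP (y · z)) ⊎ (¬ InP (x · z) × InP (y · z)))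

Reduced : Set
Reduced = ∀ x y → ¬ (x ≈ y) → Distinguishable x y

-- Give every word a summary: the parity of its a's, a degree in which b, c and d n weigh 1, 2 and
-- n + 4, and a tag recording a c or the largest d n.  Summaries add up under concatenation, and a
-- defining relation changes a summary only by dropping a tag whose degree is past its threshold,
-- which `norm` forgets anyway.  So norm ∘ summary is an invariant of Q, and since every word
-- rewrites to the normal form a^e b^k, a^e c or a^e b^k d n (k ≤ n) that it names, a complete one:
-- Q is the set of normal forms and P a decidable set of them.  Multiplying by a^e b^j d N with N large gives some b^i d N or a b^i d N whose
-- membership in P only sees the a-parity and the parity of the degree; taking N just below the
-- larger degree pushes only one of the two products past the threshold of d N; and forms with the
-- same a-parity and degree are separated by multiplying with a suitable a^δ b^j.
module Submission where

open import Defs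
open import Data.Bool using (Bool; true; false; _∧_)
open import Data.Nat using (ℕ; zero; suc; _+_; _*_; _∸_; _≤_; _<_; _⊔_; z≤n; s≤s; parity)
open import Data.Nat.Properties
open import Data.Nat.Tactic.RingSolver using (solve-∀)
open import Data.Nat.Divisibility using (divides)
open import Data.Parity.Base using (Parity; 0ℙ; 1ℙ; _⁻¹) renaming (_+_ to _+ₚ_)
import Data.Parity.Properties as ℙ
import Algebra.Properties.CommutativeSemigroup as CommSemigroupProperties
open import Data.List using ([]; _∷_; _++_)
open import Data.List.Properties using (++-assoc; ++-identityʳ)
open import Data.Product using (_×_; _,_; swap)
open import Data.Sum using (_⊎_; inj₁; inj₂)
open import Relation.Nullary using (¬_; yes; no)
open import Relation.Nullary.Decidable using (recompute; _×-dec_)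
open import Relation.Nullary.Negation using (contradiction)
open import Relation.Binary.PropositionalEquality
open import Relation.Binary.Definitions using (tri<; tri≈; tri>)
open import Function using (_∘_)
open import Relation.Binary.Bundles using (Setoid)
open import Function.Bundles using (_⇔_; mk⇔; Equivalence)
import Relation.Binary.Reasoning.Setoid as SetoidReasoning

open CommSemigroupProperties ℙ.+-commutativeSemigroup using () renaming (xy∙z≈xz∙y to +ₚ-swapʳ)
open CommSemigroupProperties +-commutativeSemigroup using () renaming (xy∙z≈xz∙y to +-swapʳ)

0<+suc : ∀ m n → 0 < m + suc n
0<+suc m n = ≤-trans (s≤s z≤n) (m≤n+m (suc n) m)

^-+ : ∀ g m n → g ^ (m + n) ≡ g ^ m ++ g ^ n
^-+ g zero    n = refl
^-+ g (suc m) n = cong (g ∷_) (^-+ g m n)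

is1ℙ : Parity → Bool
is1ℙ 0ℙ = false
is1ℙ 1ℙ = true

is1ℙ≡true : ∀ {x} → is1ℙ x ≡ true → x ≡ 1ℙ
is1ℙ≡true {1ℙ} _ = refl

parity-suc : ∀ n → parity (suc n) ≡ parity n ⁻¹
parity-suc n = sym (ℙ.⁻¹-selfInverse (ℙ.suc-homo-⁻¹ n))

parity-double : ∀ n → parity (n + n) ≡ 0ℙ
parity-double n = trans (ℙ.+-homo-+ n n) (ℙ.p+p≡0ℙ (parity n))

parity-odd-sum : ∀ K → parity (K + suc K) ≡ 1ℙ
parity-odd-sum K = trans (cong parity (+-suc K K)) (trans (parity-suc (K + K)) (cong _⁻¹ (parity-double K)))

+ₚ-cancelˡ : ∀ x y → x +ₚ (x +ₚ y) ≡ y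
+ₚ-cancelˡ x y = trans (sym (ℙ.+-assoc x x y)) (cong (_+ₚ y) (ℙ.p+p≡0ℙ x))

+ₚ-cancelʳ : ∀ e p → (e +ₚ p) +ₚ p ≡ e
+ₚ-cancelʳ e p = trans (ℙ.+-assoc e p p) (trans (cong (e +ₚ_) (ℙ.p+p≡0ℙ p)) (ℙ.+-identityʳ e))

+ₚ-⁻¹ : ∀ x y → x +ₚ y ⁻¹ ≡ (x +ₚ y) ⁻¹
+ₚ-⁻¹ 0ℙ y = refl
+ₚ-⁻¹ 1ℙ y = refl

+ₚ-parity-suc : ∀ e n → e +ₚ parity (suc n) ≡ (e +ₚ parity n) ⁻¹
+ₚ-parity-suc e n = trans (cong (e +ₚ_) (parity-suc n)) (+ₚ-⁻¹ e (parity n))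

+ₚ≡0ℙ⇒≡ : ∀ x y → x +ₚ y ≡ 0ℙ → x ≡ y
+ₚ≡0ℙ⇒≡ x y eq = ℙ.+-cancelˡ-≡ x x y (trans (ℙ.p+p≡0ℙ x) (sym eq))

parity-+≡1ℙ : ∀ m n → parity (m + n) ≡ 1ℙ → parity m ≡ parity n ⁻¹
parity-+≡1ℙ m n odd = +ₚ≡0ℙ⇒≡ (parity m) (parity n ⁻¹)
  (trans (+ₚ-⁻¹ (parity m) (parity n)) (cong _⁻¹ (trans (sym (ℙ.+-homo-+ m n)) odd)))

even⇒parity≡0ℙ : ∀ {n} → Even n → parity n ≡ 0ℙ
even⇒parity≡0ℙ (divides q refl) = parity-*2 q
  where
  parity-*2 : ∀ q → parity (q * 2) ≡ 0ℙ
  parity-*2 zero = refl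
  parity-*2 (suc q) = parity-*2 q

parity≡0ℙ⇒even : ∀ n → parity n ≡ 0ℙ → Even n
parity≡0ℙ⇒even zero _ = divides 0 refl
parity≡0ℙ⇒even (suc (suc n)) p with parity≡0ℙ⇒even n p
... | divides q refl = divides (suc q) refl

odd⇒parity≡1ℙ : ∀ {n} → Odd n → parity n ≡ 1ℙ
odd⇒parity≡1ℙ {n} odd with parity n in eq
... | 1ℙ = refl
... | 0ℙ = contradiction (parity≡0ℙ⇒even n eq) odd

parity≡1ℙ⇒odd : ∀ {n} → parity n ≡ 1ℙ → Odd n
parity≡1ℙ⇒odd p even with trans (sym p) (even⇒parity≡0ℙ even)
... | ()

-- Summaries of words

data Tag : Set where
  untagged c-tag : Tag
  d-tag : ℕ → Tag

infixl 6 _⊛_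
_⊛_ : Tag → Tag → Tag
untagged ⊛ t        = t
c-tag    ⊛ untagged = c-tag
c-tag    ⊛ c-tag    = untagged
c-tag    ⊛ d-tag n  = d-tag n
d-tag m  ⊛ untagged = d-tag m
d-tag m  ⊛ c-tag    = d-tag m
d-tag m  ⊛ d-tag n  = d-tag (m ⊔ n)

⊛-comm : ∀ s t → s ⊛ t ≡ t ⊛ s
⊛-comm untagged  untagged  = refl
⊛-comm untagged  c-tag     = refl
⊛-comm untagged  (d-tag n) = refl
⊛-comm c-tag     untagged  = refl
⊛-comm c-tag     c-tag     = refl
⊛-comm c-tag     (d-tag n) = refl
⊛-comm (d-tag m) untagged  = refl
⊛-comm (d-tag m) c-tag     = refl
⊛-comm (d-tag m) (d-tag n) = cong d-tag (⊔-comm m n)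

⊛-assoc : ∀ s t u → (s ⊛ t) ⊛ u ≡ s ⊛ (t ⊛ u)
⊛-assoc untagged  t         u         = refl
⊛-assoc c-tag     untagged  u         = refl
⊛-assoc c-tag     c-tag     untagged  = refl
⊛-assoc c-tag     c-tag     c-tag     = refl
⊛-assoc c-tag     c-tag     (d-tag o) = refl
⊛-assoc c-tag     (d-tag n) untagged  = refl
⊛-assoc c-tag     (d-tag n) c-tag     = refl
⊛-assoc c-tag     (d-tag n) (d-tag o) = refl
⊛-assoc (d-tag m) untagged  u         = refl
⊛-assoc (d-tag m) c-tag     untagged  = refl
⊛-assoc (d-tag m) c-tag     c-tag     = refl
⊛-assoc (d-tag m) c-tag     (d-tag o) = refl
⊛-assoc (d-tag m) (d-tag n) untagged  = refl
⊛-assoc (d-tag m) (d-tag n) c-tag     = refl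
⊛-assoc (d-tag m) (d-tag n) (d-tag o) = cong d-tag (⊔-assoc m n o)

minDegree : Tag → ℕ
minDegree untagged  = 0
minDegree c-tag     = 2
minDegree (d-tag n) = 4 + n

-- Beyond its threshold a tag is absorbed: bc = ab³ and b^(n+1) d n = a^(n+1) b^(2n+5).
threshold : Tag → ℕ
threshold untagged  = 0
threshold c-tag     = 2
threshold (d-tag n) = n + (4 + n)

minDegree-⊛ : ∀ s t → minDegree (s ⊛ t) ≤ minDegree s + minDegree t
minDegree-⊛ untagged  t         = ≤-refl
minDegree-⊛ c-tag     untagged  = ≤-refl
minDegree-⊛ c-tag     c-tag     = z≤n
minDegree-⊛ c-tag     (d-tag n) = m≤n+m (4 + n) 2
minDegree-⊛ (d-tag m) untagged  = m≤m+n (4 + m) 0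
minDegree-⊛ (d-tag m) c-tag     = m≤m+n (4 + m) 2
minDegree-⊛ (d-tag m) (d-tag n) =
  ≤-trans (+-monoʳ-≤ 4 (m⊔n≤m+n m n)) (+-monoʳ-≤ 4 (+-monoʳ-≤ m (m≤n+m n 4)))

⊛-absorbed : ∀ t {K N} → minDegree t ≤ K → K ≤ 4 + N → t ⊛ d-tag N ≡ d-tag N
⊛-absorbed untagged  _   _  = refl
⊛-absorbed c-tag     _   _  = refl
⊛-absorbed (d-tag n) adm K≤ = cong d-tag (m≤n⇒m⊔n≡n (+-cancelˡ-≤ 4 _ _ (≤-trans adm K≤)))

record Summary : Set where
  constructor ⟨_,_,_⟩
  field
    aParity : Parity
    degree  : ℕ
    tag     : Tag
open Summary

infixr 6 _⊕_
_⊕_ : Summary → Summary → Summary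
⟨ e , K , s ⟩ ⊕ ⟨ e′ , K′ , t ⟩ = ⟨ e +ₚ e′ , K + K′ , s ⊛ t ⟩

⊕-comm : ∀ x y → x ⊕ y ≡ y ⊕ x
⊕-comm ⟨ e , K , s ⟩ ⟨ e′ , K′ , t ⟩
  rewrite ℙ.+-comm e e′ | +-comm K K′ | ⊛-comm s t = refl

⊕-assoc : ∀ x y z → (x ⊕ y) ⊕ z ≡ x ⊕ (y ⊕ z)
⊕-assoc ⟨ e , K , s ⟩ ⟨ e′ , K′ , t ⟩ ⟨ e″ , K″ , u ⟩
  rewrite ℙ.+-assoc e e′ e″ | +-assoc K K′ K″ | ⊛-assoc s t u = refl

⊕-swap : ∀ x y z → x ⊕ (y ⊕ z) ≡ y ⊕ (x ⊕ z)
⊕-swap x y z = begin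
  x ⊕ (y ⊕ z) ≡⟨ ⊕-assoc x y z ⟨
  (x ⊕ y) ⊕ z ≡⟨ cong (_⊕ z) (⊕-comm x y) ⟩
  (y ⊕ x) ⊕ z ≡⟨ ⊕-assoc y x z ⟩
  y ⊕ (x ⊕ z) ∎
  where open ≡-Reasoning

Admissible : Summary → Set
Admissible r = minDegree (tag r) ≤ degree r

⊕-admissible : ∀ x y → Admissible x → Admissible y → Admissible (x ⊕ y)
⊕-admissible ⟨ _ , K , s ⟩ ⟨ _ , K′ , t ⟩ adm adm′ = ≤-trans (minDegree-⊛ s t) (+-mono-≤ adm adm′)

-- c is counted as a b², and d n as a^(n+1) b^(n+4), following bc = ab³ and b^(n+1) d n = a^(n+1) b^(2n+5).
genSummary : Gen → Summary
genSummary a     = ⟨ 1ℙ , 0 , untagged ⟩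
genSummary b     = ⟨ 0ℙ , 1 , untagged ⟩
genSummary c     = ⟨ 1ℙ , 2 , c-tag ⟩
genSummary (d n) = ⟨ parity (suc n) , 4 + n , d-tag n ⟩

summary : Word → Summary
summary []      = ⟨ 0ℙ , 0 , untagged ⟩
summary (g ∷ w) = genSummary g ⊕ summary w

summary-++ : ∀ u v → summary (u ++ v) ≡ summary u ⊕ summary v
summary-++ []      v = refl
summary-++ (g ∷ u) v =
  trans (cong (genSummary g ⊕_) (summary-++ u v)) (sym (⊕-assoc (genSummary g) (summary u) (summary v)))

summary-admissible : ∀ w → Admissible (summary w)
summary-admissible []      = z≤n
summary-admissible (g ∷ w) =
  ⊕-admissible (genSummary g) (summary w) (gen-admissible g) (summary-admissible w)
  where
  gen-admissible : ∀ g → Admissible (genSummary g)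
  gen-admissible a     = z≤n
  gen-admissible b     = z≤n
  gen-admissible c     = ≤-refl
  gen-admissible (d n) = ≤-refl

summary-a^ : ∀ k → summary (a ^ k) ≡ ⟨ parity k , 0 , untagged ⟩
summary-a^ zero    = refl
summary-a^ (suc k) =
  trans (cong (genSummary a ⊕_) (summary-a^ k)) (cong (λ e → ⟨ e , 0 , untagged ⟩) (sym (parity-suc k)))

summary-b^ : ∀ k → summary (b ^ k) ≡ ⟨ 0ℙ , k , untagged ⟩
summary-b^ zero    = refl
summary-b^ (suc k) = cong (genSummary b ⊕_) (summary-b^ k)

-- Normal forms

data NF : Set where
  A : Parity → ℕ → NF
  C : Parity → NF
  D : Parity → (k n : ℕ) → .(k ≤ n) → NF

aPow : Parity → Word
aPow 0ℙ = []
aPow 1ℙ = a ∷ []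

abWord : Parity → ℕ → Word
abWord e k = aPow e ++ b ^ k

abdWord : Parity → ℕ → ℕ → Word
abdWord e k n = aPow e ++ b ^ k ++ d n ∷ []

embed : NF → Word
embed (A e k)     = abWord e k
embed (C e)       = aPow e ++ c ∷ []
embed (D e k n _) = abdWord e k n

dSummary : Parity → ℕ → ℕ → Summary
dSummary e k n = ⟨ e +ₚ parity (suc n) , k + (4 + n) , d-tag n ⟩

-- The summary of embed q.
⌜_⌝ : NF → Summary
⌜ A e k ⌝     = ⟨ e , k , untagged ⟩
⌜ C e ⌝       = ⟨ e ⁻¹ , 2 , c-tag ⟩
⌜ D e k n _ ⌝ = dSummary e k n

⌜⌝-admissible : ∀ q → Admissible ⌜ q ⌝
⌜⌝-admissible (A e k)     = z≤n
⌜⌝-admissible (C e)       = ≤-refl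
⌜⌝-admissible (D e k n _) = m≤n+m (4 + n) k

summary-aPow : ∀ e → summary (aPow e) ≡ ⟨ e , 0 , untagged ⟩
summary-aPow 0ℙ = refl
summary-aPow 1ℙ = refl

summary-abWord : ∀ e k → summary (abWord e k) ≡ ⟨ e , k , untagged ⟩
summary-abWord e k rewrite summary-++ (aPow e) (b ^ k) | summary-aPow e | summary-b^ k
  | ℙ.+-identityʳ e = refl

summary-abdWord : ∀ e k n → summary (abdWord e k n) ≡ dSummary e k n
summary-abdWord e k n rewrite summary-++ (aPow e) (b ^ k ++ d n ∷ []) | summary-++ (b ^ k) (d n ∷ [])
  | summary-aPow e | summary-b^ k | ℙ.+-identityʳ (parity (suc n)) | +-identityʳ (4 + n) = refl

normC : Parity → ℕ → NF
normC e 0 = A e 0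
normC e 1 = A e 1
normC e 2 = C (e ⁻¹)
normC e (suc (suc (suc K))) = A e (3 + K)

normD : Parity → ℕ → ℕ → NF
normD e K n with K ≤? threshold (d-tag n)
... | yes K≤ = D (e +ₚ parity (suc n)) (K ∸ (4 + n)) n live
  where
  live : K ∸ (4 + n) ≤ n
  live = subst (K ∸ (4 + n) ≤_) (m+n∸n≡m n (4 + n)) (∸-monoˡ-≤ (4 + n) K≤)
... | no _ = A e K

norm : Summary → NF
norm ⟨ e , K , untagged ⟩ = A e K
norm ⟨ e , K , c-tag ⟩    = normC e K
norm ⟨ e , K , d-tag n ⟩  = normD e K n

eval : Word → NF
eval w = norm (summary w)

D-cong : ∀ {e e′ k k′ n} .{h : k ≤ n} .{h′ : k′ ≤ n} →
         e ≡ e′ → k ≡ k′ → D e k n h ≡ D e′ k′ n h′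
D-cong refl refl = refl

normD-live : ∀ e k n .(k≤n : k ≤ n) → normD (e +ₚ parity (suc n)) (k + (4 + n)) n ≡ D e k n k≤n
normD-live e k n k≤n with k + (4 + n) ≤? threshold (d-tag n)
... | yes _     = D-cong (+ₚ-cancelʳ e _) (m+n∸n≡m k (4 + n))
... | no ¬live  = contradiction (+-monoˡ-≤ (4 + n) (recompute (k ≤? n) k≤n)) ¬live

normD-dead : ∀ e K n → threshold (d-tag n) < K → normD e K n ≡ A e K
normD-dead e K n dead with K ≤? threshold (d-tag n)
... | yes live = contradiction live (<⇒≱ dead)
... | no _     = refl

norm-dead : ∀ e K t → threshold t < K → norm ⟨ e , K , t ⟩ ≡ A e K
norm-dead e K untagged _ = refl
norm-dead e (suc (suc (suc K))) c-tag _ = refl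
norm-dead e 0 c-tag ()
norm-dead e 1 c-tag (s≤s ())
norm-dead e 2 c-tag (s≤s (s≤s ()))
norm-dead e K (d-tag n) dead = normD-dead e K n dead

⌜norm⌝-live : ∀ e K t → minDegree t ≤ K → K ≤ threshold t →
  ⌜ norm ⟨ e , K , t ⟩ ⌝ ≡ ⟨ e , K , t ⟩
⌜norm⌝-live e K untagged _ _ = refl
⌜norm⌝-live e 2 c-tag _ _ = cong (λ e′ → ⟨ e′ , 2 , c-tag ⟩) (ℙ.⁻¹-involutive e)
⌜norm⌝-live e 0 c-tag () _
⌜norm⌝-live e 1 c-tag (s≤s ()) _
⌜norm⌝-live e (suc (suc (suc K))) c-tag _ (s≤s (s≤s ()))
⌜norm⌝-live e K (d-tag n) adm live with K ≤? threshold (d-tag n)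
... | yes _ = cong₂ (λ e′ K′ → ⟨ e′ , K′ , d-tag n ⟩) (+ₚ-cancelʳ e _) (m∸n+n≡m adm)
... | no ¬live = contradiction live ¬live

norm-⊛-dead : ∀ e K s t → threshold s < K → norm ⟨ e , K , s ⊛ t ⟩ ≡ norm ⟨ e , K , t ⟩
norm-⊛-dead e K untagged t _ = refl
norm-⊛-dead e K c-tag untagged dead = norm-dead e K c-tag dead
norm-⊛-dead e K c-tag c-tag dead = sym (norm-dead e K c-tag dead)
norm-⊛-dead e K c-tag (d-tag n) _ = refl
norm-⊛-dead e K (d-tag m) untagged dead = norm-dead e K (d-tag m) dead
norm-⊛-dead e K (d-tag m) c-tag dead =
  trans (norm-dead e K (d-tag m) dead)
        (sym (norm-dead e K c-tag (≤-<-trans (≤-trans (m≤m+n 2 (2 + m)) (m≤n+m (4 + m) m)) dead)))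
norm-⊛-dead e K (d-tag m) (d-tag n) dead with ≤-total m n
... | inj₁ m≤n rewrite m≤n⇒m⊔n≡n m≤n = refl
... | inj₂ n≤m rewrite m≥n⇒m⊔n≡m n≤m =
  trans (norm-dead e K (d-tag m) dead)
        (sym (norm-dead e K (d-tag n) (≤-<-trans (+-mono-≤ n≤m (+-monoʳ-≤ 4 n≤m)) dead)))

norm-⌜norm⌝-⊕ : ∀ r y → Admissible r → norm (⌜ norm r ⌝ ⊕ y) ≡ norm (r ⊕ y)
norm-⌜norm⌝-⊕ ⟨ e , K , t ⟩ ⟨ e′ , K′ , t′ ⟩ adm with K ≤? threshold t
... | yes live = cong (λ r → norm (r ⊕ ⟨ e′ , K′ , t′ ⟩)) (⌜norm⌝-live e K t adm live)
... | no dead rewrite norm-dead e K t (≰⇒> dead) =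
  sym (norm-⊛-dead (e +ₚ e′) (K + K′) t t′ (≤-trans (≰⇒> dead) (m≤m+n K K′)))

eval-++ : ∀ x z → eval (x ++ z) ≡ norm (⌜ eval x ⌝ ⊕ summary z)
eval-++ x z =
  trans (cong norm (summary-++ x z)) (sym (norm-⌜norm⌝-⊕ (summary x) (summary z) (summary-admissible x)))

-- norm ∘ summary is an invariant of Q

summary-a^b^ : ∀ n → summary (a ^ suc n ++ b ^ (2 * n + 5)) ≡ ⟨ parity (suc n) , suc n + (4 + n) , untagged ⟩
summary-a^b^ n = begin
  summary (a ^ suc n ++ b ^ (2 * n + 5))
    ≡⟨ summary-++ (a ^ suc n) (b ^ (2 * n + 5)) ⟩
  summary (a ^ suc n) ⊕ summary (b ^ (2 * n + 5))
    ≡⟨ cong₂ _⊕_ (summary-a^ (suc n)) (summary-b^ (2 * n + 5)) ⟩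
  ⟨ parity (suc n) +ₚ 0ℙ , 2 * n + 5 , untagged ⟩
    ≡⟨ cong₂ (λ e K → ⟨ e , K , untagged ⟩) (ℙ.+-identityʳ _) (2n+5≡ n) ⟩
  ⟨ parity (suc n) , suc n + (4 + n) , untagged ⟩ ∎
  where
  2n+5≡ : ∀ n → 2 * n + 5 ≡ suc n + (4 + n)
  2n+5≡ = solve-∀
  open ≡-Reasoning

summary-dd : ∀ {m n} → m ≤ n → summary (d m ∷ d n ∷ []) ≡ summary (a ^ suc m ++ b ^ (m + 4) ++ d n ∷ [])
summary-dd {m} {n} m≤n = begin
  summary (d m ∷ d n ∷ [])
    ≡⟨ cong₂ (λ e K → ⟨ parity (suc m) +ₚ e , 4 + m + K , d-tag (m ⊔ n) ⟩)
             (ℙ.+-identityʳ _) (+-identityʳ _) ⟩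
  ⟨ parity (suc m) +ₚ parity (suc n) , 4 + m + (4 + n) , d-tag (m ⊔ n) ⟩
    ≡⟨ cong₂ (λ K t → ⟨ parity (suc m) +ₚ parity (suc n) , K , t ⟩)
             (cong (_+ (4 + n)) (+-comm 4 m)) (cong d-tag (m≤n⇒m⊔n≡n m≤n)) ⟩
  ⟨ parity (suc m) +ₚ parity (suc n) , m + 4 + (4 + n) , d-tag n ⟩
    ≡⟨ cong₂ _⊕_ (summary-a^ (suc m)) (summary-abdWord 0ℙ (m + 4) n) ⟨
  summary (a ^ suc m) ⊕ summary (b ^ (m + 4) ++ d n ∷ [])
    ≡⟨ summary-++ (a ^ suc m) (b ^ (m + 4) ++ d n ∷ []) ⟨
  summary (a ^ suc m ++ b ^ (m + 4) ++ d n ∷ []) ∎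
  where open ≡-Reasoning

relation-preserves-norm : ∀ {l r} → Rel l r → ∀ z → norm (summary l ⊕ z) ≡ norm (summary r ⊕ z)
relation-preserves-norm (comm g h) z = cong (λ s → norm (s ⊕ z)) (⊕-swap (genSummary g) (genSummary h) _)
relation-preserves-norm r-a² z = refl
relation-preserves-norm r-bc ⟨ e , K , t ⟩ = norm-⊛-dead (1ℙ +ₚ e) (3 + K) c-tag t (s≤s (s≤s (s≤s z≤n)))
relation-preserves-norm r-c² z = refl
relation-preserves-norm (r-bd n) z@(⟨ e , K , t ⟩) = begin
  norm (summary (b ^ suc n ++ d n ∷ []) ⊕ z)
    ≡⟨ cong (λ s → norm (s ⊕ z)) (summary-abdWord 0ℙ (suc n) n) ⟩
  norm ⟨ parity (suc n) +ₚ e , suc n + (4 + n) + K , d-tag n ⊛ t ⟩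
    ≡⟨ norm-⊛-dead _ _ (d-tag n) t (m≤m+n (suc n + (4 + n)) K) ⟩
  norm ⟨ parity (suc n) +ₚ e , suc n + (4 + n) + K , t ⟩
    ≡⟨ cong (λ s → norm (s ⊕ z)) (summary-a^b^ n) ⟨
  norm (summary (a ^ suc n ++ b ^ (2 * n + 5)) ⊕ z) ∎
  where open ≡-Reasoning
relation-preserves-norm (r-cd n) z = refl
relation-preserves-norm (r-dd m n m≤n) z = cong (λ s → norm (s ⊕ z)) (summary-dd m≤n)

summary-infix : ∀ p m s → summary (p ++ m ++ s) ≡ summary m ⊕ (summary p ⊕ summary s)
summary-infix p m s = begin
  summary (p ++ m ++ s)                   ≡⟨ summary-++ p (m ++ s) ⟩
  summary p ⊕ summary (m ++ s)            ≡⟨ cong (summary p ⊕_) (summary-++ m s) ⟩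
  summary p ⊕ (summary m ⊕ summary s)     ≡⟨ ⊕-swap (summary p) (summary m) (summary s) ⟩
  summary m ⊕ (summary p ⊕ summary s)     ∎
  where open ≡-Reasoning

eval-cong : ∀ {x y} → x ≈ y → eval x ≡ eval y
eval-cong (step p l r s rel) = begin
  norm (summary (p ++ l ++ s))               ≡⟨ cong norm (summary-infix p l s) ⟩
  norm (summary l ⊕ (summary p ⊕ summary s)) ≡⟨ relation-preserves-norm rel (summary p ⊕ summary s) ⟩
  norm (summary r ⊕ (summary p ⊕ summary s)) ≡⟨ cong norm (summary-infix p r s) ⟨
  norm (summary (p ++ r ++ s))               ∎
  where open ≡-Reasoning
eval-cong ≈-refl            = refl
eval-cong (≈-sym x≈y)       = sym (eval-cong x≈y)
eval-cong (≈-trans x≈y y≈z) = trans (eval-cong x≈y) (eval-cong y≈z)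

-- Every word equals its normal form

≈-setoid : Setoid _ _
≈-setoid = record
  { Carrier       = Word
  ; _≈_           = _≈_
  ; isEquivalence = record { refl = ≈-refl ; sym = ≈-sym ; trans = ≈-trans }
  }

module ≈-Reasoning = SetoidReasoning ≈-setoid

≈-congˡ : ∀ u {x y} → x ≈ y → u ++ x ≈ u ++ y
≈-congˡ u (step p l r s rel) = subst₂ _≈_ (++-assoc u p (l ++ s)) (++-assoc u p (r ++ s)) (step (u ++ p) l r s rel)
≈-congˡ u ≈-refl            = ≈-refl
≈-congˡ u (≈-sym x≈y)       = ≈-sym (≈-congˡ u x≈y)
≈-congˡ u (≈-trans x≈y y≈z) = ≈-trans (≈-congˡ u x≈y) (≈-congˡ u y≈z)

rel-at-end : ∀ u {l r} → Rel l r → u ++ l ≈ u ++ r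
rel-at-end u {l} {r} rel =
  subst₂ (λ l′ r′ → u ++ l′ ≈ u ++ r′) (++-identityʳ l) (++-identityʳ r) (step u l r [] rel)

move-past : ∀ g u w → g ∷ u ++ w ≈ u ++ g ∷ w
move-past g []      w = ≈-refl
move-past g (h ∷ u) w =
  ≈-trans (step [] (g ∷ h ∷ []) (h ∷ g ∷ []) (u ++ w) (comm g h)) (≈-congˡ (h ∷ []) (move-past g u w))

++-swap-≈ : ∀ u v w → u ++ v ++ w ≈ v ++ u ++ w
++-swap-≈ []      v w = ≈-refl
++-swap-≈ (g ∷ u) v w = ≈-trans (≈-congˡ (g ∷ []) (++-swap-≈ u v w)) (move-past g v (u ++ w))

aPow-merge : ∀ e f w → aPow e ++ aPow f ++ w ≈ aPow (e +ₚ f) ++ w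
aPow-merge 0ℙ f  w = ≈-refl
aPow-merge 1ℙ 0ℙ w = ≈-refl
aPow-merge 1ℙ 1ℙ w = step [] (a ^ 2) [] w r-a²

a^-aPow : ∀ k w → a ^ k ++ w ≈ aPow (parity k) ++ w
a^-aPow zero    w = ≈-refl
a^-aPow (suc k) w = begin
  a ∷ a ^ k ++ w                   ≈⟨ ≈-congˡ (a ∷ []) (a^-aPow k w) ⟩
  aPow 1ℙ ++ aPow (parity k) ++ w  ≈⟨ aPow-merge 1ℙ (parity k) w ⟩
  aPow (parity k ⁻¹) ++ w          ≡⟨ cong (λ e → aPow e ++ w) (parity-suc k) ⟨
  aPow (parity (suc k)) ++ w       ∎
  where open ≈-Reasoning

pull-a^ : ∀ e u k w → aPow e ++ u ++ a ^ k ++ w ≈ aPow (e +ₚ parity k) ++ u ++ w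
pull-a^ e u k w = begin
  aPow e ++ u ++ a ^ k ++ w                ≈⟨ ≈-congˡ (aPow e) (≈-congˡ u (a^-aPow k w)) ⟩
  aPow e ++ u ++ aPow (parity k) ++ w      ≈⟨ ≈-congˡ (aPow e) (++-swap-≈ u (aPow (parity k)) w) ⟩
  aPow e ++ aPow (parity k) ++ u ++ w      ≈⟨ aPow-merge e (parity k) (u ++ w) ⟩
  aPow (e +ₚ parity k) ++ u ++ w           ∎
  where open ≈-Reasoning

b^-join : ∀ k l w → b ^ k ++ b ^ l ++ w ≡ b ^ (k + l) ++ w
b^-join k l w = trans (sym (++-assoc (b ^ k) (b ^ l) w)) (cong (_++ w) (sym (^-+ b k l)))

Sound : Word → Set
Sound w = w ≈ embed (eval w)

-- Since eval is invariant, soundness can be moved along ≈ without computing any summaries.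
sound-transport : ∀ {x y} → x ≈ y → Sound y → Sound x
sound-transport {y = y} x≈y sound-y = ≈-trans x≈y (subst (λ q → y ≈ embed q) (sym (eval-cong x≈y)) sound-y)

sound-A : ∀ e k → Sound (abWord e k)
sound-A e k = subst (λ r → abWord e k ≈ embed (norm r)) (sym (summary-abWord e k)) ≈-refl

sound-C : ∀ e → Sound (aPow e ++ c ∷ [])
sound-C 0ℙ = ≈-refl
sound-C 1ℙ = ≈-refl

bd-reduce : ∀ e j n → abdWord e (j + suc n) n ≈ abWord (e +ₚ parity (suc n)) (j + (2 * n + 5))
bd-reduce e j n = begin
  aPow e ++ b ^ (j + suc n) ++ d n ∷ []                  ≡⟨ cong (aPow e ++_) (b^-join j (suc n) (d n ∷ [])) ⟨
  aPow e ++ b ^ j ++ b ^ suc n ++ d n ∷ []                ≈⟨ ≈-congˡ (aPow e) (rel-at-end (b ^ j) (r-bd n)) ⟩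
  aPow e ++ b ^ j ++ a ^ suc n ++ b ^ (2 * n + 5)         ≈⟨ pull-a^ e (b ^ j) (suc n) (b ^ (2 * n + 5)) ⟩
  aPow (e +ₚ parity (suc n)) ++ b ^ j ++ b ^ (2 * n + 5)  ≡⟨ cong (_ ++_) (^-+ b j (2 * n + 5)) ⟨
  aPow (e +ₚ parity (suc n)) ++ b ^ (j + (2 * n + 5))     ∎
  where open ≈-Reasoning

eval-abd : ∀ e k n .(k≤n : k ≤ n) → eval (abdWord e k n) ≡ D e k n k≤n
eval-abd e k n k≤n = trans (cong norm (summary-abdWord e k n)) (normD-live e k n k≤n)

sound-abd : ∀ e k n → Sound (abdWord e k n)
sound-abd e k n with k ≤? n
... | yes k≤n = subst (λ q → abdWord e k n ≈ embed q) (sym (eval-abd e k n k≤n)) ≈-refl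
... | no k≰n = subst (λ k → Sound (abdWord e k n)) (m∸n+n≡m (≰⇒> k≰n))
  (sound-transport (bd-reduce e (k ∸ suc n) n) (sound-A (e +ₚ parity (suc n)) _))

sound-dd : ∀ e k {m n} → m ≤ n → Sound (aPow e ++ b ^ k ++ d m ∷ d n ∷ [])
sound-dd e k {m} {n} m≤n = sound-transport reduce (sound-abd (e +ₚ parity (suc m)) (k + (m + 4)) n)
  where
  open ≈-Reasoning
  reduce : aPow e ++ b ^ k ++ d m ∷ d n ∷ [] ≈ aPow (e +ₚ parity (suc m)) ++ b ^ (k + (m + 4)) ++ d n ∷ []
  reduce = begin
    aPow e ++ b ^ k ++ d m ∷ d n ∷ []                             ≈⟨ ≈-congˡ (aPow e) (rel-at-end (b ^ k) (r-dd m n m≤n)) ⟩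
    aPow e ++ b ^ k ++ a ^ suc m ++ b ^ (m + 4) ++ d n ∷ []        ≈⟨ pull-a^ e (b ^ k) (suc m) _ ⟩
    aPow (e +ₚ parity (suc m)) ++ b ^ k ++ b ^ (m + 4) ++ d n ∷ []  ≡⟨ cong (aPow (e +ₚ parity (suc m)) ++_) (b^-join k (m + 4) _) ⟩
    aPow (e +ₚ parity (suc m)) ++ b ^ (k + (m + 4)) ++ d n ∷ []     ∎

sound-a : ∀ q → Sound (a ∷ embed q)
sound-a (A e k)     = sound-transport (aPow-merge 1ℙ e _) (sound-A (1ℙ +ₚ e) k)
sound-a (C e)       = sound-transport (aPow-merge 1ℙ e _) (sound-C (1ℙ +ₚ e))
sound-a (D e k n _) = sound-transport (aPow-merge 1ℙ e _) (sound-abd (1ℙ +ₚ e) k n)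

sound-b : ∀ q → Sound (b ∷ embed q)
sound-b (A e k)     = sound-transport (move-past b (aPow e) _) (sound-A e (suc k))
sound-b (C e)       = sound-transport reduce (sound-A (e +ₚ 1ℙ) 3)
  where
  open ≈-Reasoning
  reduce : b ∷ aPow e ++ c ∷ [] ≈ aPow (e +ₚ 1ℙ) ++ b ^ 3
  reduce = begin
    b ∷ aPow e ++ c ∷ []   ≈⟨ move-past b (aPow e) _ ⟩
    aPow e ++ b ∷ c ∷ []   ≈⟨ rel-at-end (aPow e) r-bc ⟩
    aPow e ++ a ∷ b ^ 3    ≈⟨ pull-a^ e [] 1 _ ⟩
    aPow (e +ₚ 1ℙ) ++ b ^ 3 ∎
sound-b (D e k n _) = sound-transport (move-past b (aPow e) _) (sound-abd e (suc k) n)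

sound-c : ∀ q → Sound (c ∷ embed q)
sound-c (A e zero)    = sound-transport (move-past c (aPow e) []) (sound-C e)
sound-c (A e (suc k)) = sound-transport reduce (sound-A (e +ₚ 1ℙ) (3 + k))
  where
  open ≈-Reasoning
  reduce : c ∷ aPow e ++ b ∷ b ^ k ≈ aPow (e +ₚ 1ℙ) ++ b ^ (3 + k)
  reduce = begin
    c ∷ aPow e ++ b ∷ b ^ k        ≈⟨ move-past c (aPow e) _ ⟩
    aPow e ++ c ∷ b ∷ b ^ k        ≈⟨ ≈-congˡ (aPow e) (step [] _ _ (b ^ k) (comm c b)) ⟩
    aPow e ++ b ∷ c ∷ b ^ k        ≈⟨ ≈-congˡ (aPow e) (step [] _ _ (b ^ k) r-bc) ⟩
    aPow e ++ a ∷ b ^ (3 + k)      ≈⟨ pull-a^ e [] 1 _ ⟩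
    aPow (e +ₚ 1ℙ) ++ b ^ (3 + k)  ∎
sound-c (C e)         = sound-transport (≈-trans (move-past c (aPow e) _) (rel-at-end (aPow e) r-c²)) (sound-A e 4)
sound-c (D e k n _)   = sound-transport reduce (sound-abd (e +ₚ 1ℙ) (k + 2) n)
  where
  open ≈-Reasoning
  reduce : c ∷ aPow e ++ b ^ k ++ d n ∷ [] ≈ aPow (e +ₚ 1ℙ) ++ b ^ (k + 2) ++ d n ∷ []
  reduce = begin
    c ∷ aPow e ++ b ^ k ++ d n ∷ []             ≈⟨ move-past c (aPow e) _ ⟩
    aPow e ++ c ∷ b ^ k ++ d n ∷ []             ≈⟨ ≈-congˡ (aPow e) (move-past c (b ^ k) _) ⟩
    aPow e ++ b ^ k ++ c ∷ d n ∷ []             ≈⟨ ≈-congˡ (aPow e) (rel-at-end (b ^ k) (r-cd n)) ⟩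
    aPow e ++ b ^ k ++ a ∷ b ^ 2 ++ d n ∷ []    ≈⟨ pull-a^ e (b ^ k) 1 _ ⟩
    aPow (e +ₚ 1ℙ) ++ b ^ k ++ b ^ 2 ++ d n ∷ [] ≡⟨ cong (aPow (e +ₚ 1ℙ) ++_) (b^-join k 2 _) ⟩
    aPow (e +ₚ 1ℙ) ++ b ^ (k + 2) ++ d n ∷ []   ∎

sound-d : ∀ m q → Sound (d m ∷ embed q)
sound-d m (A e k) = sound-transport reduce (sound-abd e k m)
  where
  open ≈-Reasoning
  reduce : d m ∷ aPow e ++ b ^ k ≈ aPow e ++ b ^ k ++ d m ∷ []
  reduce = begin
    d m ∷ aPow e ++ b ^ k          ≈⟨ move-past (d m) (aPow e) _ ⟩
    aPow e ++ d m ∷ b ^ k          ≡⟨ cong (λ w → aPow e ++ d m ∷ w) (++-identityʳ (b ^ k)) ⟨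
    aPow e ++ d m ∷ b ^ k ++ []    ≈⟨ ≈-congˡ (aPow e) (move-past (d m) (b ^ k) []) ⟩
    aPow e ++ b ^ k ++ d m ∷ []    ∎
sound-d m (C e) = sound-transport reduce (sound-abd (e +ₚ 1ℙ) 2 m)
  where
  open ≈-Reasoning
  reduce : d m ∷ aPow e ++ c ∷ [] ≈ aPow (e +ₚ 1ℙ) ++ b ^ 2 ++ d m ∷ []
  reduce = begin
    d m ∷ aPow e ++ c ∷ []              ≈⟨ move-past (d m) (aPow e) _ ⟩
    aPow e ++ d m ∷ c ∷ []              ≈⟨ rel-at-end (aPow e) (comm (d m) c) ⟩
    aPow e ++ c ∷ d m ∷ []              ≈⟨ rel-at-end (aPow e) (r-cd m) ⟩
    aPow e ++ a ∷ b ^ 2 ++ d m ∷ []     ≈⟨ pull-a^ e [] 1 _ ⟩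
    aPow (e +ₚ 1ℙ) ++ b ^ 2 ++ d m ∷ [] ∎
sound-d m (D e k n _) with ≤-total m n
... | inj₁ m≤n = sound-transport bring-together (sound-dd e k m≤n)
  where
  bring-together : d m ∷ aPow e ++ b ^ k ++ d n ∷ [] ≈ aPow e ++ b ^ k ++ d m ∷ d n ∷ []
  bring-together = ≈-trans (move-past (d m) (aPow e) _) (≈-congˡ (aPow e) (move-past (d m) (b ^ k) _))
... | inj₂ n≤m = sound-transport bring-together (sound-dd e k n≤m)
  where
  bring-together : d m ∷ aPow e ++ b ^ k ++ d n ∷ [] ≈ aPow e ++ b ^ k ++ d n ∷ d m ∷ []
  bring-together = ≈-trans (move-past (d m) (aPow e) _)
    (≈-congˡ (aPow e) (≈-trans (move-past (d m) (b ^ k) _) (rel-at-end (b ^ k) (comm (d m) (d n)))))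

sound-gen : ∀ g q → Sound (g ∷ embed q)
sound-gen a     = sound-a
sound-gen b     = sound-b
sound-gen c     = sound-c
sound-gen (d m) = sound-d m

sound : ∀ w → Sound w
sound []      = ≈-refl
sound (g ∷ w) = sound-transport (≈-congˡ (g ∷ []) (sound w)) (sound-gen g (eval w))

eval-injective : ∀ x y → eval x ≡ eval y → x ≈ y
eval-injective x y eq = ≈-trans (sound x) (subst (λ q → embed q ≈ y) (sym eq) (≈-sym (sound y)))

isP : NF → Bool
isP (A 1ℙ zero)    = true
isP (A 1ℙ (suc _)) = false
isP (A 0ℙ zero)    = false
isP (A 0ℙ (suc k)) = is1ℙ (parity k)
isP (C _)          = false
-- a^e b^k d n ∈ P iff e ≡ parity n and k + n is odd; k < n follows as k ≤ n.
isP (D e k n _)    = is1ℙ (e +ₚ parity (suc n)) ∧ is1ℙ (parity (k + n))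

isP-A1ℙ : ∀ K → 0 < K → isP (A 1ℙ K) ≢ true
isP-A1ℙ (suc K) _ ()

isP-A0ℙ : ∀ K → 0 < K → parity K ≡ 0ℙ → isP (A 0ℙ K) ≡ true
isP-A0ℙ (suc K) _ even = cong is1ℙ (sym (ℙ.⁻¹-selfInverse (trans (sym (parity-suc K)) even)))

D-condition : ∀ e x y → is1ℙ (e +ₚ y ⁻¹) ∧ is1ℙ (x +ₚ y) ≡ true ⇔ (e ≡ y × x ≡ y ⁻¹)
D-condition e x y = mk⇔ (to e x y) (λ { (refl , refl) → from y })
  where
  to : ∀ e x y → is1ℙ (e +ₚ y ⁻¹) ∧ is1ℙ (x +ₚ y) ≡ true → e ≡ y × x ≡ y ⁻¹
  to 0ℙ 1ℙ 0ℙ _ = refl , refl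
  to 1ℙ 0ℙ 1ℙ _ = refl , refl
  to 0ℙ 0ℙ 0ℙ ()
  to 0ℙ 0ℙ 1ℙ ()
  to 0ℙ 1ℙ 1ℙ ()
  to 1ℙ 0ℙ 0ℙ ()
  to 1ℙ 1ℙ 0ℙ ()
  to 1ℙ 1ℙ 1ℙ ()
  from : ∀ y → is1ℙ (y +ₚ y ⁻¹) ∧ is1ℙ (y ⁻¹ +ₚ y) ≡ true
  from 0ℙ = refl
  from 1ℙ = refl

isP-D : ∀ e k n .(k≤n : k ≤ n) → isP (D e k n k≤n) ≡ true ⇔ (e ≡ parity n × parity k ≡ parity n ⁻¹)
isP-D e k n _ rewrite parity-suc n | ℙ.+-homo-+ k n = D-condition e (parity k) (parity n)

D-condition⇒< : ∀ {k n} → k ≤ n → parity k ≡ parity n ⁻¹ → k < n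
D-condition⇒< {k} k≤n opposite = ≤∧≢⇒< k≤n (λ { refl → ℙ.p≢p⁻¹ (parity k) opposite })

PForm⇒isP : ∀ {w} → PForm w → isP (eval w) ≡ true
PForm⇒isP pa = refl
PForm⇒isP (pb (suc m) _) = trans (cong (λ r → isP (norm r)) (summary-b^ (2 * suc m)))
  (isP-A0ℙ (2 * suc m) (s≤s z≤n) (even⇒parity≡0ℙ (divides (suc m) (*-comm 2 (suc m)))))
PForm⇒isP (pbd k n odd even k<n) = trans (cong isP (eval-abd 0ℙ k n (<⇒≤ k<n)))
  (Equivalence.from (isP-D 0ℙ k n (<⇒≤ k<n))
    (sym (even⇒parity≡0ℙ even) , trans (odd⇒parity≡1ℙ odd) (cong _⁻¹ (sym (even⇒parity≡0ℙ even)))))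
PForm⇒isP (pabd k n even odd k<n) = trans (cong isP (eval-abd 1ℙ k n (<⇒≤ k<n)))
  (Equivalence.from (isP-D 1ℙ k n (<⇒≤ k<n))
    (sym (odd⇒parity≡1ℙ odd) , trans (even⇒parity≡0ℙ even) (cong _⁻¹ (sym (odd⇒parity≡1ℙ odd)))))

isP⇒PForm : ∀ q → isP q ≡ true → PForm (embed q)
isP⇒PForm (A 1ℙ zero) _ = pa
isP⇒PForm (A 0ℙ (suc k)) odd with parity≡0ℙ⇒even (suc k) (trans (parity-suc k) (cong _⁻¹ (is1ℙ≡true odd)))
... | divides (suc m) eq = subst PForm (cong (b ^_) (trans (*-comm 2 (suc m)) (sym eq))) (pb (suc m) (s≤s z≤n))
isP⇒PForm (D 0ℙ k n k≤n) inP with Equivalence.to (isP-D 0ℙ k n k≤n) inP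
... | even , opposite =
  pbd k n (parity≡1ℙ⇒odd (trans opposite (cong _⁻¹ (sym even)))) (parity≡0ℙ⇒even n (sym even))
      (D-condition⇒< (recompute (k ≤? n) k≤n) opposite)
isP⇒PForm (D 1ℙ k n k≤n) inP with Equivalence.to (isP-D 1ℙ k n k≤n) inP
... | odd , opposite =
  pabd k n (parity≡0ℙ⇒even k (trans opposite (cong _⁻¹ (sym odd)))) (parity≡1ℙ⇒odd (sym odd))
      (D-condition⇒< (recompute (k ≤? n) k≤n) opposite)

InP⇔isP : ∀ w → InP w ⇔ isP (eval w) ≡ true
InP⇔isP w = mk⇔
  (λ { (w′ , pform , w≈w′) → trans (cong isP (eval-cong w≈w′)) (PForm⇒isP pform) })
  (λ inP → embed (eval w) , isP⇒PForm (eval w) inP , sound w)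

-- Separating normal forms

Accepts : NF → Word → Set
Accepts q z = isP (norm (⌜ q ⌝ ⊕ summary z)) ≡ true

Separates : Word → NF → NF → Set
Separates z q q′ = Accepts q z × ¬ Accepts q′ z

record Separable (q q′ : NF) : Set where
  constructor separated-by
  field
    test      : Word
    separates : Separates test q q′ ⊎ Separates test q′ q

Separable-sym : ∀ {q q′} → Separable q q′ → Separable q′ q
Separable-sym (separated-by z (inj₁ s)) = separated-by z (inj₂ s)
Separable-sym (separated-by z (inj₂ s)) = separated-by z (inj₁ s)

⌜⌝-⊕-abdWord : ∀ q δ j N → degree ⌜ q ⌝ ≤ 4 + N →
  ⌜ q ⌝ ⊕ summary (abdWord δ j N) ≡ dSummary (aParity ⌜ q ⌝ +ₚ δ) (degree ⌜ q ⌝ + j) N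
⌜⌝-⊕-abdWord q δ j N K≤ with ⌜ q ⌝ | ⌜⌝-admissible q
... | ⟨ e , K , t ⟩ | adm rewrite summary-abdWord δ j N | ℙ.+-assoc e δ (parity (suc N)) | +-assoc K j (4 + N)
  | ⊛-absorbed t adm K≤ = refl

⌜D⌝-⊕-abWord : ∀ e k n .(h : k ≤ n) δ j →
  ⌜ D e k n h ⌝ ⊕ summary (abWord δ j) ≡ dSummary (e +ₚ δ) (k + j) n
⌜D⌝-⊕-abWord e k n _ δ j rewrite summary-abWord δ j =
  cong₂ (λ e′ K → ⟨ e′ , K , d-tag n ⟩) (+ₚ-swapʳ e (parity (suc n)) δ) (+-swapʳ k (4 + n) j)

Accepts-live : ∀ q z {e k n} → ⌜ q ⌝ ⊕ summary z ≡ dSummary e k n → k ≤ n →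
  Accepts q z ⇔ (e ≡ parity n × parity k ≡ parity n ⁻¹)
Accepts-live q z {e} {k} {n} product k≤n rewrite product | normD-live e k n k≤n = isP-D e k n k≤n

Accepts-dead : ∀ q z {e k n} → ⌜ q ⌝ ⊕ summary z ≡ dSummary e k n → n < k → e ≡ parity n → ¬ Accepts q z
Accepts-dead q z {k = k} {n} product n<k refl rewrite product
  | normD-dead (parity n +ₚ parity (suc n)) (k + (4 + n)) n (+-monoˡ-< (4 + n) n<k)
  | +ₚ-parity-suc (parity n) n | ℙ.p+p≡0ℙ (parity n) = isP-A1ℙ (k + (4 + n)) (0<+suc k (3 + n))

accepts-abdWord : ∀ q N → parity N ≡ 0ℙ → degree ⌜ q ⌝ + suc (degree ⌜ q ⌝) ≤ N →
  Accepts q (abdWord (aParity ⌜ q ⌝) (suc (degree ⌜ q ⌝)) N)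
accepts-abdWord q N even bound = Equivalence.from (Accepts-live q (abdWord e (suc K) N) product bound)
  (trans (ℙ.p+p≡0ℙ e) (sym even) , trans (parity-odd-sum K) (cong _⁻¹ (sym even)))
  where
  e : Parity
  e = aParity ⌜ q ⌝
  K : ℕ
  K = degree ⌜ q ⌝
  product : ⌜ q ⌝ ⊕ summary (abdWord e (suc K) N) ≡ dSummary (e +ₚ e) (K + suc K) N
  product = ⌜⌝-⊕-abdWord q e (suc K) N (≤-trans (≤-trans (m≤m+n K (suc K)) bound) (m≤n+m N 4))

separate-by-character : ∀ q q′ →
  ¬ (aParity ⌜ q ⌝ ≡ aParity ⌜ q′ ⌝ × parity (degree ⌜ q ⌝) ≡ parity (degree ⌜ q′ ⌝)) → Separable q q′
separate-by-character q q′ different =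
  separated-by (abdWord e (suc K) N) (inj₁ (accepts-abdWord q N (parity-double s) bound , reject))
  where
  e : Parity
  e = aParity ⌜ q ⌝
  K K′ s N : ℕ
  K  = degree ⌜ q ⌝
  K′ = degree ⌜ q′ ⌝
  s  = suc (K + K′)
  N  = s + s
  bound : K + suc K ≤ N
  bound = +-mono-≤ (≤-trans (m≤m+n K K′) (n≤1+n _)) (s≤s (m≤m+n K K′))
  bound′ : K′ + suc K ≤ N
  bound′ = +-mono-≤ (≤-trans (m≤n+m K′ K) (n≤1+n _)) (s≤s (m≤m+n K K′))
  product : ⌜ q′ ⌝ ⊕ summary (abdWord e (suc K) N) ≡ dSummary (aParity ⌜ q′ ⌝ +ₚ e) (K′ + suc K) N
  product = ⌜⌝-⊕-abdWord q′ e (suc K) N (≤-trans (≤-trans (m≤m+n K′ (suc K)) bound′) (m≤n+m N 4))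
  reject : ¬ Accepts q′ (abdWord e (suc K) N)
  reject accept with Equivalence.to (Accepts-live q′ (abdWord e (suc K) N) product bound′) accept
  ... | same-a , opposite = different
    ( sym (+ₚ≡0ℙ⇒≡ (aParity ⌜ q′ ⌝) e (trans same-a (parity-double s)))
    , sym (trans (parity-+≡1ℙ K′ (suc K) (trans opposite (cong _⁻¹ (parity-double s))))
                 (trans (cong _⁻¹ (parity-suc K)) (ℙ.⁻¹-involutive (parity K)))))

separate-by-degree : ∀ q q′ →
  aParity ⌜ q ⌝ ≡ aParity ⌜ q′ ⌝ → parity (degree ⌜ q ⌝) ≡ parity (degree ⌜ q′ ⌝) →
  degree ⌜ q ⌝ < degree ⌜ q′ ⌝ → Separable q q′
separate-by-degree q q′ same-a same-parity K<K′ = separated-by (abdWord e (suc K) N) (inj₁ (accept , reject))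
  where
  e : Parity
  e = aParity ⌜ q ⌝
  K K′ N : ℕ
  K  = degree ⌜ q ⌝
  K′ = degree ⌜ q′ ⌝
  N  = K′ + K
  even : parity N ≡ 0ℙ
  even = trans (ℙ.+-homo-+ K′ K) (trans (cong (_+ₚ parity K) (sym same-parity)) (ℙ.p+p≡0ℙ (parity K)))
  accept : Accepts q (abdWord e (suc K) N)
  accept = accepts-abdWord q N even (≤-trans (≤-reflexive (+-suc K K)) (+-monoˡ-≤ K K<K′))
  reject : ¬ Accepts q′ (abdWord e (suc K) N)
  reject = Accepts-dead q′ (abdWord e (suc K) N)
    (⌜⌝-⊕-abdWord q′ e (suc K) N (≤-trans (m≤m+n K′ K) (m≤n+m N 4)))
    (≤-reflexive (sym (+-suc K′ K)))
    (trans (cong (_+ₚ e) (sym same-a)) (trans (ℙ.p+p≡0ℙ e) (sym even)))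

separate-AC : ∀ e → Separable (A (e ⁻¹) 2) (C e)
separate-AC 0ℙ = separated-by (abWord 1ℙ 0) (inj₁ (refl , λ ()))
separate-AC 1ℙ = separated-by (abWord 0ℙ 0) (inj₁ (refl , λ ()))

separate-AD : ∀ e k n .(h : k ≤ n) → Separable (A (e +ₚ parity (suc n)) (k + (4 + n))) (D e k n h)
separate-AD e k n h with m≤n⇒m<n∨m≡n (recompute (k ≤? n) h)
... | inj₂ refl = separated-by (abWord x 0) (inj₁ (accept , reject))
  where
  x : Parity
  x = e +ₚ parity (suc k)
  accept : Accepts (A x (k + (4 + k))) (abWord x 0)
  accept rewrite summary-abWord x 0 | ℙ.p+p≡0ℙ x | +-identityʳ (k + (4 + k)) =
    isP-A0ℙ (k + (4 + k)) (0<+suc k (3 + k)) (trans (ℙ.+-homo-+ k (4 + k)) (ℙ.p+p≡0ℙ (parity k)))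
  reject : ¬ Accepts (D e k k h) (abWord x 0)
  reject accept
    with Equivalence.to (Accepts-live (D e k k h) (abWord x 0) {e +ₚ x} (⌜D⌝-⊕-abWord e k k h x 0) (≤-reflexive (+-identityʳ k)))
                        accept
  ... | _ , opposite = ℙ.p≢p⁻¹ (parity k) (trans (cong parity (sym (+-identityʳ k))) opposite)
... | inj₁ k<n with m≤n⇒∃[o]m+o≡n k<n
...   | o , refl = separated-by (abWord δ o) (inj₂ (accept , reject))
  where
  δ : Parity
  δ = e +ₚ parity (suc (k + o))
  accept : Accepts (D e k (suc (k + o)) h) (abWord δ o)
  accept = Equivalence.from
    (Accepts-live (D e k (suc (k + o)) h) (abWord δ o) (⌜D⌝-⊕-abWord e k (suc (k + o)) h δ o) (n≤1+n (k + o)))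
    (+ₚ-cancelˡ e _ , trans (sym (ℙ.⁻¹-involutive _)) (cong _⁻¹ (sym (parity-suc (k + o)))))
  reject : ¬ Accepts (A (e +ₚ parity (suc (suc (k + o)))) (k + (4 + suc (k + o)))) (abWord δ o)
  reject rewrite summary-abWord δ o | +ₚ-parity-suc e (suc (k + o)) | ℙ.p⁻¹+p≡1ℙ (e +ₚ parity (suc (k + o))) =
    isP-A1ℙ _ (≤-trans (0<+suc k (4 + k + o)) (m≤m+n _ o))

degree-shift : ∀ k′ k s r → k′ + (4 + (suc (k + s) + r)) ≡ (k′ + suc r) + (4 + (k + s))
degree-shift = solve-∀

separate-DD : ∀ e k n e′ k′ n′ .(h : k ≤ n) .(h′ : k′ ≤ n′) →
  e +ₚ parity (suc n) ≡ e′ +ₚ parity (suc n′) → k + (4 + n) ≡ k′ + (4 + n′) → n < n′ →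
  Separable (D e′ k′ n′ h′) (D e k n h)
separate-DD e k n e′ k′ n′ h h′ same-a same-degree n<n′
  with m≤n⇒∃[o]m+o≡n h | m≤n⇒∃[o]m+o≡n n<n′
... | s , refl | r , refl with +-cancelʳ-≡ (4 + (k + s)) k (k′ + suc r) (trans same-degree (degree-shift k′ k s r))
...   | refl = separated-by (abWord δ (suc s)) (inj₁ (accept , reject))
  where
  N N′ : ℕ
  N  = k′ + suc r + s
  N′ = suc N + r
  δ : Parity
  δ = e′ +ₚ parity N′
  live : k′ + suc s ≤ N′
  live = ≤-trans (≤-reflexive (+-suc k′ s)) (s≤s (≤-trans (+-monoˡ-≤ s (m≤m+n k′ (suc r))) (m≤m+n N r)))
  sum-odd : ∀ k′ s r → k′ + suc s + suc (k′ + suc r + s + r) ≡ suc ((k′ + s + suc r) + (k′ + s + suc r))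
  sum-odd = solve-∀
  opposite : parity (k′ + suc s) ≡ parity N′ ⁻¹
  opposite = parity-+≡1ℙ (k′ + suc s) N′ (trans (cong parity (sum-odd k′ s r))
    (trans (parity-suc (k′ + s + suc r + (k′ + s + suc r))) (cong _⁻¹ (parity-double (k′ + s + suc r)))))
  accept : Accepts (D e′ k′ N′ h′) (abWord δ (suc s))
  accept = Equivalence.from
    (Accepts-live (D e′ k′ N′ h′) (abWord δ (suc s)) (⌜D⌝-⊕-abWord e′ k′ N′ h′ δ (suc s)) live)
    (+ₚ-cancelˡ e′ (parity N′) , opposite)
  same-a′ : e′ +ₚ parity N′ ≡ e +ₚ parity N
  same-a′ = ℙ.⁻¹-injective (trans (sym (+ₚ-parity-suc e′ N′)) (trans (sym same-a) (+ₚ-parity-suc e N)))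
  reject : ¬ Accepts (D e (k′ + suc r) N h) (abWord δ (suc s))
  reject = Accepts-dead (D e (k′ + suc r) N h) (abWord δ (suc s)) (⌜D⌝-⊕-abWord e (k′ + suc r) N h δ (suc s))
    (≤-reflexive (sym (+-suc (k′ + suc r) s))) (trans (cong (e +ₚ_) same-a′) (+ₚ-cancelˡ e (parity N)))

degree-D≢2 : ∀ k n → 2 ≢ k + (4 + n)
degree-D≢2 k n eq =
  contradiction (subst (4 ≤_) (sym eq) (≤-trans (m≤m+n 4 n) (m≤n+m (4 + n) k))) λ { (s≤s (s≤s ())) }

separate-same-character : ∀ q q′ → q ≢ q′ →
  aParity ⌜ q ⌝ ≡ aParity ⌜ q′ ⌝ → degree ⌜ q ⌝ ≡ degree ⌜ q′ ⌝ → Separable q q′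
separate-same-character (A e K) (A e′ K′) q≢q′ refl refl = contradiction refl q≢q′
separate-same-character (A e K) (C e′) _ refl refl = separate-AC e′
separate-same-character (A e K) (D e′ k n h) _ refl refl = separate-AD e′ k n h
separate-same-character (C e) (A e′ K′) _ refl refl = Separable-sym (separate-AC e)
separate-same-character (C e) (C e′) q≢q′ same-a _ = contradiction (cong C (ℙ.⁻¹-injective same-a)) q≢q′
separate-same-character (C e) (D e′ k n h) _ _ same-degree = contradiction same-degree (degree-D≢2 k n)
separate-same-character (D e k n h) (A e′ K′) _ refl refl = Separable-sym (separate-AD e k n h)
separate-same-character (D e k n h) (C e′) _ _ same-degree = contradiction (sym same-degree) (degree-D≢2 k n)
separate-same-character (D e k n h) (D e′ k′ n′ h′) q≢q′ same-a same-degree with <-cmp n n′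
... | tri< n<n′ _ _ = Separable-sym (separate-DD e k n e′ k′ n′ h h′ same-a same-degree n<n′)
... | tri> _ _ n′<n = separate-DD e′ k′ n′ e k n h′ h (sym same-a) (sym same-degree) n′<n
... | tri≈ _ refl _ =
  contradiction (D-cong (ℙ.+-cancelʳ-≡ (parity (suc n)) e e′ same-a) (+-cancelʳ-≡ (4 + n) k k′ same-degree))
                q≢q′

separate : ∀ q q′ → q ≢ q′ → Separable q q′
separate q q′ q≢q′
  with aParity ⌜ q ⌝ ℙ.≟ aParity ⌜ q′ ⌝ ×-dec parity (degree ⌜ q ⌝) ℙ.≟ parity (degree ⌜ q′ ⌝)
... | no different = separate-by-character q q′ different
... | yes (same-a , same-parity) with <-cmp (degree ⌜ q ⌝) (degree ⌜ q′ ⌝)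
...   | tri< K<K′ _ _     = separate-by-degree q q′ same-a same-parity K<K′
...   | tri> _ _ K′<K     = Separable-sym (separate-by-degree q′ q (sym same-a) (sym same-parity) K′<K)
...   | tri≈ _ same-K _   = separate-same-character q q′ q≢q′ same-a same-K

InP⇔Accepts : ∀ x z → InP (x · z) ⇔ Accepts (eval x) z
InP⇔Accepts x z rewrite sym (eval-++ x z) = InP⇔isP (x ++ z)

Separates⇒InP : ∀ x y {z} → Separates z (eval x) (eval y) → InP (x · z) × ¬ InP (y · z)
Separates⇒InP x y {z} (accept , reject) =
  Equivalence.from (InP⇔Accepts x z) accept , reject ∘ Equivalence.to (InP⇔Accepts y z)

mainTheorem4 : Reduced
mainTheorem4 x y x≉y with separate (eval x) (eval y) (x≉y ∘ eval-injective x y)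
... | separated-by z (inj₁ separates) = z , inj₁ (Separates⇒InP x y separates)
... | separated-by z (inj₂ separates) = z , inj₂ (swap (Separates⇒InP y x separates))
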